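{- Let $P$ be a reverse semi-standard Young tableau. Then the augmented filling $\rho^{ -1}(P)$ constructed from $P$ as described in the context is a semi-skyline augmented filling.
   Context: Diagrams are drawn French style: row $1$ of a partition shape is the bottom row. A reverse semi-standard Young tableau is a filling of the Young diagram of a partition with positive integers whose entries are strictly decreasing along each row (left to right) and weakly decreasing up each column (bottom to top). Weak compositions $\gamma=(\gamma_1,\gamma_2,\dots)$ have infinitely many parts, finitely many nonzero. The augmented diagram of $\gamma$ consists of the cells $(i,j)$, $i\ge1$, $0\le j\le\gamma_i$; row $0$ is the basement; column $i$ has height $\gamma_i$. An augmented filling $F$ assigns a positive integer to each cell, with $F(i,0)=i$ for all $i\ge1$. A descent is a pair of cells $(i,j+1),(i,j)$ with $F(i,j+1)>F(i,j)$. Let $I(x,y)=1$ if $x>y$ and $0$ otherwise. A type A triple consists of cells $a_1=(i_1,j)$, $a_2=(i_2,j)$, $a_3=(i_1,j-1)$ with $j\ge1$, $i_1<i_2$, $\gamma_{i_1}\ge\gamma_{i_2}$; it is an inversion triple if $I(F(a_1),F(a_2))+I(F(a_2),F(a_3))-I(F(a_1),F(a_3))=1$. A type B triple consists of cells $a_1=(i_1,j)$, $a_2=(i_2,j)$, $a_3=(i_2,j+1)$ with $j\ge0$, $i_1<i_2$, $\gamma_{i_2}>\gamma_{i_1}$; it is an inversion triple if $I(F(a_3),F(a_1))+I(F(a_1),F(a_2))-I(F(a_3),F(a_2))=1$. A semi-skyline augmented filling (SSAF) is an augmented filling with no descents in which every type A and type B triple is an inversion triple. Construction of $\rho^{ -1}(P)$: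 start with the augmented filling consisting only of the basement (cell $(i,0)$ containing $i$ for every $i\ge1$). For $h=1,2,\dots$ in turn, take the entries of row $h$ of $P$ in decreasing order; each such entry $\alpha$ is placed in a new cell in row $h$, directly on top of the leftmost cell of row $h-1$ of the current filling whose entry is $\ge\alpha$ and whose cell directly above is still empty. -}

module Defs where

open import Data.Nat using (ℕ; zero; suc; _+_; _∸_; _≤_; _<_; _⊔_; _≡ᵇ_; _≤ᵇ_)
open import Data.Bool using (Bool; true; false; if_then_else_; _∧_)
open import Data.List using (List; []; _∷_; length; _++_; map; upTo; concat; foldr)
open import Data.Maybe using (Maybe; just; nothing)
open import Data.Product using (Σ; ∃; _×_)
open import Data.Integer as ℤ using (ℤ; +_)
open import Relation.Binary.PropositionalEquality using (_≡_)

-- k-th entry (0-based) of a list, 0 if out of range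
at : List ℕ → ℕ → ℕ
at []       _       = 0
at (x ∷ xs) zero    = x
at (x ∷ xs) (suc k) = at xs k

rowAt : List (List ℕ) → ℕ → List ℕ
rowAt []       _       = []
rowAt (r ∷ rs) zero    = r
rowAt (r ∷ rs) (suc k) = rowAt rs k

-- Tableaux (French convention).  A tableau P is a list of rows, the
-- head being row 1 (the bottom row); each row is listed left to right.
-- Paper row h  =  list index h - 1.

record IsReverseSSYT (P : List (List ℕ)) : Set where
  field
    rowsNonempty : ∀ h → h < length P → 0 < length (rowAt P h)
    shape        : ∀ h → length (rowAt P (suc h)) ≤ length (rowAt P h)
    positive     : ∀ h k → k < length (rowAt P h) → 0 < at (rowAt P h) k
    rowStrict    : ∀ h k → suc k < length (rowAt P h) →
                   at (rowAt P h) (suc k) < at (rowAt P h) k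
    colWeak      : ∀ h k → k < length (rowAt P (suc h)) →
                   at (rowAt P (suc h)) k ≤ at (rowAt P h) k

-- A filling is given by its columns: C i is the list of entries of
-- column i in rows 1, 2, ..., γ_i (bottom to top).  The basement entry
-- F(i,0) = i is implicit.  Only columns i ≥ 1 are used (C 0 is ignored).

Filling : Set
Filling = ℕ → List ℕ

ht : Filling → ℕ → ℕ
ht C i = length (C i)

val : Filling → ℕ → ℕ → ℕ
val C i zero    = i
val C i (suc j) = at (C i) j

I : ℕ → ℕ → ℕ
I x y = if y ≤ᵇ x then (if x ≡ᵇ y then 0 else 1) else 0

Iℤ : ℕ → ℕ → ℤ
Iℤ x y = + I x y

record IsAugmentedFilling (C : Filling) : Set where
  field
    finite   : ∃ λ N → ∀ i → N < i → C i ≡ []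
    positive : ∀ i j → 1 ≤ i → 1 ≤ j → j ≤ ht C i → 0 < val C i j

record IsSSAF (C : Filling) : Set where
  field
    augmented : IsAugmentedFilling C
    noDescent : ∀ i j → 1 ≤ i → suc j ≤ ht C i → val C i (suc j) ≤ val C i j
    -- type A triples: a1=(i1,j), a2=(i2,j), a3=(i1,j-1), j ≥ 1,
    -- i1 < i2, γ_{i1} ≥ γ_{i2}; all three cells in the diagram
    typeA : ∀ i₁ i₂ j → 1 ≤ i₁ → i₁ < i₂ → ht C i₂ ≤ ht C i₁ →
            1 ≤ j → j ≤ ht C i₂ →
            Iℤ (val C i₁ j) (val C i₂ j) ℤ.+ Iℤ (val C i₂ j) (val C i₁ (j ∸ 1))
              ℤ.- Iℤ (val C i₁ j) (val C i₁ (j ∸ 1)) ≡ + 1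
    -- type B triples: a1=(i1,j), a2=(i2,j), a3=(i2,j+1), j ≥ 0,
    -- i1 < i2, γ_{i2} > γ_{i1}; all three cells in the diagram
    typeB : ∀ i₁ i₂ j → 1 ≤ i₁ → i₁ < i₂ → ht C i₁ < ht C i₂ →
            j ≤ ht C i₁ →
            Iℤ (val C i₂ (suc j)) (val C i₁ j) ℤ.+ Iℤ (val C i₁ j) (val C i₂ j)
              ℤ.- Iℤ (val C i₂ (suc j)) (val C i₂ j) ≡ + 1

maxEntry : List (List ℕ) → ℕ
maxEntry P = foldr _⊔_ 0 (concat P)

-- leftmost column i among the candidates whose top cell is in row r
-- (so the cell (i,r) exists and (i,r+1) is empty) and F(i,r) ≥ α
findCol : Filling → ℕ → ℕ → List ℕ → Maybe ℕ
findCol C r α []       = nothing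
findCol C r α (i ∷ is) =
  if (ht C i ≡ᵇ r) ∧ (α ≤ᵇ val C i r) then just i else findCol C r α is

addOnTop : Filling → ℕ → ℕ → Filling
addOnTop C i α k = if k ≡ᵇ i then C i ++ (α ∷ []) else C k

-- place the entries of one row (paper row r+1), in the given order
placeRow : ℕ → ℕ → List ℕ → Filling → Maybe Filling
placeRow M r []       C = just C
placeRow M r (α ∷ as) C with findCol C r α (map suc (upTo M))
... | nothing = nothing
... | just i  = placeRow M r as (addOnTop C i α)

build : ℕ → ℕ → List (List ℕ) → Filling → Maybe Filling
build M r []         C = just C
build M r (row ∷ rows) C with placeRow M r row C
... | nothing = nothing
... | just C' = build M (suc r) rows C'

ρinv : List (List ℕ) → Maybe Filling
ρinv P = build (maxEntry P) 0 P (λ _ → [])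

-- The entries of each row of P are inserted in decreasing order, each on the leftmost column
-- whose top lies in the row below and is at least as large. Besides positivity and the absence
-- of descents, every intermediate filling is LeftCovered: if a cell (i₂,k+1) would fit on (i₁,k)
-- with i₁ < i₂, then (i₁,k+1) already carries a larger entry. An insertion preserves this because
-- every column to its left was rejected and the entries already placed in its row are larger.
-- LeftCovered gives the type A triples directly, and the type B triples because climbing it shows
-- that a column fitting on a column to its left is no taller than that column.
-- Every insertion finds a column by counting: for each v, a row of P has at most as many entries
-- ≥ v as the row below it (columns weakly decrease), and those entries became the tops ≥ v of
-- the columns ending in that row.

module Submission where

open import Defs
open import Data.Bool using (Bool; true; false; T; _∧_; if_then_else_)
open import Data.Bool.Properties using (T-∧)
open import Data.Empty using (⊥; ⊥-elim)
import Data.Integer as ℤ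
open import Data.List using (List; []; _∷_; length; _++_; map; upTo; applyUpTo; filter; concat; foldr)
open import Data.List.Properties using (length-++; filter-accept; filter-reject; filter-none; map-upTo)
open import Data.List.Relation.Unary.All as All using (All; []; _∷_)
open import Data.List.Relation.Unary.All.Properties using (++⁻ˡ)
open import Data.List.Relation.Unary.AllPairs as AllPairs using (AllPairs; []; _∷_)
open import Data.List.Relation.Unary.Linked using (Linked; []; [-]; _∷_)
open import Data.List.Relation.Unary.Linked.Properties using (Linked⇒AllPairs)
open import Data.Maybe using (just; nothing)
open import Data.Nat using (ℕ; zero; suc; _+_; _∸_; _≤_; _<_; _>_; _⊔_; _≡ᵇ_; _≤ᵇ_; _≤?_; _≟_; z≤n; s≤s)
open import Data.Nat.Properties
open import Data.Product using (Σ; _×_; _,_; proj₁; proj₂)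
open import Data.Sum using (_⊎_; inj₁; inj₂)
open import Function using (Equivalence; _∘_)
open import Relation.Binary.PropositionalEquality
open import Relation.Nullary using (¬_; yes; no)

I-> : ∀ {x y} → y < x → I x y ≡ 1
I-> {x} {y} y<x with y ≤ᵇ x | ≤⇒≤ᵇ (<⇒≤ y<x)
... | true | _ with x ≡ᵇ y | ≡ᵇ⇒≡ x y
...   | false | _    = refl
...   | true  | x≡y = ⊥-elim (>⇒≢ y<x (x≡y _))

I-≤ : ∀ {x y} → x ≤ y → I x y ≡ 0
I-≤ {x} {y} x≤y with y ≤ᵇ x | ≤ᵇ⇒≤ y x
... | false | _   = refl
... | true  | y≤x with x ≡ᵇ y | ≡⇒≡ᵇ x y (≤-antisym x≤y (y≤x _))
...   | true | _ = refl

inversionTriple : ∀ {x y z} → x ≤ z → (y ≤ z → y < x) →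
                  Iℤ x y ℤ.+ Iℤ y z ℤ.- Iℤ x z ≡ ℤ.+ 1
inversionTriple {x} {y} {z} x≤z cover with y ≤? z
... | yes y≤z rewrite I-> (cover y≤z) | I-≤ y≤z | I-≤ x≤z = refl
... | no y≰z  rewrite I-≤ (≤-trans x≤z (<⇒≤ (≰⇒> y≰z))) | I-> (≰⇒> y≰z) | I-≤ x≤z = refl

countTo : (ℕ → Bool) → ℕ → ℕ
countTo p zero    = 0
countTo p (suc n) = if p (suc n) then suc (countTo p n) else countTo p n

countTo-none : ∀ p n → (∀ j → 1 ≤ j → j ≤ n → ¬ T (p j)) → countTo p n ≡ 0
countTo-none p zero    none = refl
countTo-none p (suc n) none with p (suc n) | none (suc n) (s≤s z≤n) ≤-refl
... | true  | ¬p[n+1] = ⊥-elim (¬p[n+1] _)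
... | false | _       = countTo-none p n (λ j 1≤j j≤n → none j 1≤j (m≤n⇒m≤1+n j≤n))

countTo-mono-suc : ∀ p n → countTo p n ≤ countTo p (suc n)
countTo-mono-suc p n with p (suc n)
... | true  = n≤1+n _
... | false = ≤-refl

countTo-suc-≤ : ∀ p n → countTo p (suc n) ≤ suc (countTo p n)
countTo-suc-≤ p n with p (suc n)
... | true  = ≤-refl
... | false = n≤1+n _

countTo-cong : ∀ p q n → (∀ j → j ≤ n → p j ≡ q j) → countTo p n ≡ countTo q n
countTo-cong p q zero    p≗q = refl
countTo-cong p q (suc n) p≗q
  rewrite p≗q (suc n) ≤-refl | countTo-cong p q n (λ j j≤n → p≗q j (m≤n⇒m≤1+n j≤n)) = refl

AgreeOff : (ℕ → Bool) → (ℕ → Bool) → ℕ → Set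
AgreeOff p q i = ∀ j → j ≢ i → p j ≡ q j

module _ (p q : ℕ → Bool) (i : ℕ) (agree : AgreeOff p q i) where

  countTo-≤-update : ¬ T (p i) → ∀ n → countTo p n ≤ countTo q n
  countTo-≤-update ¬pi zero = z≤n
  countTo-≤-update ¬pi (suc n) with suc n ≟ i
  ... | yes refl with p (suc n) | ¬pi
  ...   | true  | ¬p[n+1] = ⊥-elim (¬p[n+1] _)
  ...   | false | _ = ≤-trans (countTo-≤-update ¬pi n) (countTo-mono-suc q n)
  countTo-≤-update ¬pi (suc n) | no n+1≢i rewrite agree (suc n) n+1≢i with q (suc n)
  ...   | true  = s≤s (countTo-≤-update ¬pi n)
  ...   | false = countTo-≤-update ¬pi n

  countTo-<-update : ¬ T (p i) → T (q i) → ∀ n → 1 ≤ i → i ≤ n → countTo p n < countTo q n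
  countTo-<-update ¬pi qi zero () z≤n
  countTo-<-update ¬pi qi (suc n) 1≤i i≤n+1 with suc n ≟ i
  ... | yes refl with p (suc n) | ¬pi | q (suc n) | qi
  ...   | true  | ¬p[n+1] | _    | _ = ⊥-elim (¬p[n+1] _)
  ...   | false | _       | true | _ = s≤s (countTo-≤-update ¬pi n)
  countTo-<-update ¬pi qi (suc n) 1≤i i≤n+1 | no n+1≢i
    rewrite agree (suc n) n+1≢i with i≤n ← ≤-pred (≤∧≢⇒< i≤n+1 (n+1≢i ∘ sym)) with q (suc n)
  ...   | true  = s≤s (countTo-<-update ¬pi qi n 1≤i i≤n)
  ...   | false = countTo-<-update ¬pi qi n 1≤i i≤n

  countTo-≤-suc-update : ∀ n → countTo p n ≤ suc (countTo q n)
  countTo-≤-suc-update zero = z≤n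
  countTo-≤-suc-update (suc n) with suc n ≟ i
  ... | yes refl = begin
    countTo p (suc n)       ≤⟨ countTo-suc-≤ p n ⟩
    suc (countTo p n)       ≡⟨ cong suc (countTo-cong p q n (λ j j≤n → agree j (<⇒≢ (s≤s j≤n)))) ⟩
    suc (countTo q n)       ≤⟨ s≤s (countTo-mono-suc q n) ⟩
    suc (countTo q (suc n)) ∎
    where open ≤-Reasoning
  ... | no n+1≢i rewrite agree (suc n) n+1≢i with q (suc n)
  ...   | true  = s≤s (countTo-≤-suc-update n)
  ...   | false = countTo-≤-suc-update n

countGE : ℕ → List ℕ → ℕ
countGE v xs = length (filter (v ≤?_) xs)

countGE-accept : ∀ {v x} xs → v ≤ x → countGE v (x ∷ xs) ≡ suc (countGE v xs)
countGE-accept {v} xs v≤x = cong length (filter-accept (v ≤?_) v≤x)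

countGE-reject : ∀ {v x} xs → ¬ v ≤ x → countGE v (x ∷ xs) ≡ countGE v xs
countGE-reject {v} xs v≰x = cong length (filter-reject (v ≤?_) v≰x)

countGE-below : ∀ {v xs} → All (_< v) xs → countGE v xs ≡ 0
countGE-below {v} xs<v = cong length (filter-none (v ≤?_) (All.map <⇒≱ xs<v))

countGE-≤-cons : ∀ v x xs → countGE v xs ≤ countGE v (x ∷ xs)
countGE-≤-cons v x xs with v ≤? x
... | yes v≤x = ≤-trans (n≤1+n _) (≤-reflexive (sym (countGE-accept xs v≤x)))
... | no v≰x  = ≤-reflexive (sym (countGE-reject xs v≰x))

countGE-mono-at : ∀ ys xs → length ys ≤ length xs → (∀ k → k < length ys → at ys k ≤ at xs k) →
                  ∀ v → countGE v ys ≤ countGE v xs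
countGE-mono-at []       xs       _          _   v = z≤n
countGE-mono-at (y ∷ ys) (x ∷ xs) (s≤s len) y≤x v with v ≤? y
... | yes v≤y = begin
  countGE v (y ∷ ys)  ≡⟨ countGE-accept ys v≤y ⟩
  suc (countGE v ys)  ≤⟨ s≤s (countGE-mono-at ys xs len (λ k → y≤x (suc k) ∘ s≤s) v) ⟩
  suc (countGE v xs)  ≡⟨ countGE-accept xs (≤-trans v≤y (y≤x 0 (s≤s z≤n))) ⟨
  countGE v (x ∷ xs)  ∎
  where open ≤-Reasoning
... | no v≰y = begin
  countGE v (y ∷ ys)  ≡⟨ countGE-reject ys v≰y ⟩
  countGE v ys        ≤⟨ countGE-mono-at ys xs len (λ k → y≤x (suc k) ∘ s≤s) v ⟩
  countGE v xs        ≤⟨ countGE-≤-cons v x xs ⟩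
  countGE v (x ∷ xs)  ∎
  where open ≤-Reasoning

countGE-≤-countTo : ∀ v n xs → AllPairs _>_ xs → All (0 <_) xs → All (_≤ n) xs →
                    countGE v xs ≤ countTo (v ≤ᵇ_) n
countGE-≤-countTo v n       []       _               _          _          = z≤n
countGE-≤-countTo v zero    (x ∷ xs) _               (0<x ∷ _)  (x≤0 ∷ _)  = ⊥-elim (<⇒≱ 0<x x≤0)
countGE-≤-countTo v (suc n) (x ∷ xs) (xs<x ∷ desc) (_ ∷ pos) (x≤n+1 ∷ bound) with v ≤? x
... | no v≰x = begin
  countGE v (x ∷ xs)            ≡⟨ countGE-reject xs v≰x ⟩
  countGE v xs                  ≤⟨ countGE-≤-countTo v (suc n) xs desc pos bound ⟩
  countTo (v ≤ᵇ_) (suc n)       ∎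
  where open ≤-Reasoning
... | yes v≤x with v ≤ᵇ suc n | ≤⇒≤ᵇ (≤-trans v≤x x≤n+1)
...   | true | _ = begin
  countGE v (x ∷ xs)            ≡⟨ countGE-accept xs v≤x ⟩
  suc (countGE v xs)            ≤⟨ s≤s (countGE-≤-countTo v n xs desc pos xs≤n) ⟩
  suc (countTo (v ≤ᵇ_) n)       ∎
  where
  open ≤-Reasoning
  xs≤n : All (_≤ n) xs
  xs≤n = All.map (λ y<x → ≤-pred (≤-trans y<x x≤n+1)) xs<x

≤-foldr-⊔ : ∀ xs → All (_≤ foldr _⊔_ 0 xs) xs
≤-foldr-⊔ []       = []
≤-foldr-⊔ (x ∷ xs) = m≤m⊔n x _ ∷ All.map (λ y≤ → ≤-trans y≤ (m≤n⊔m x _)) (≤-foldr-⊔ xs)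

all-at : ∀ {Q : ℕ → Set} xs → (∀ k → k < length xs → Q (at xs k)) → All Q xs
all-at []       Q-at = []
all-at (x ∷ xs) Q-at = Q-at 0 (s≤s z≤n) ∷ all-at xs (λ k → Q-at (suc k) ∘ s≤s)

linked-at : ∀ {R : ℕ → ℕ → Set} xs → (∀ k → suc k < length xs → R (at xs k) (at xs (suc k))) →
            Linked R xs
linked-at []           R-at = []
linked-at (x ∷ [])     R-at = [-]
linked-at (x ∷ y ∷ xs) R-at = R-at 0 (s≤s (s≤s z≤n)) ∷ linked-at (y ∷ xs) (λ k → R-at (suc k) ∘ s≤s)

at-++ˡ : ∀ xs ys {k} → k < length xs → at (xs ++ ys) k ≡ at xs k
at-++ˡ (x ∷ xs) ys {zero}  _         = refl
at-++ˡ (x ∷ xs) ys {suc k} (s≤s k<) = at-++ˡ xs ys k<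

at-++-length : ∀ xs {y} ys → at (xs ++ y ∷ ys) (length xs) ≡ y
at-++-length []       ys = refl
at-++-length (x ∷ xs) ys = at-++-length xs ys

topAtLeast : Filling → ℕ → ℕ → ℕ → Bool
topAtLeast C r v j = (ht C j ≡ᵇ r) ∧ (v ≤ᵇ val C j r)

T-topAtLeast : ∀ {C r v j} → T (topAtLeast C r v j) → ht C j ≡ r × v ≤ val C j r
T-topAtLeast {C} {r} {v} {j} top with T-∧ .Equivalence.to top
... | ht≡r , v≤ = ≡ᵇ⇒≡ _ _ ht≡r , ≤ᵇ⇒≤ _ _ v≤

topAtLeast-T : ∀ {C r v j} → ht C j ≡ r → v ≤ val C j r → T (topAtLeast C r v j)
topAtLeast-T ht≡r v≤ = T-∧ .Equivalence.from (≡⇒≡ᵇ _ _ ht≡r , ≤⇒≤ᵇ v≤)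

tops : Filling → ℕ → ℕ → ℕ → ℕ
tops C r v = countTo (topAtLeast C r v)

interval : ℕ → ℕ → List ℕ
interval a zero    = []
interval a (suc n) = a ∷ interval (suc a) n

columns≡interval : ∀ M → map suc (upTo M) ≡ interval 1 M
columns≡interval M = trans (map-upTo suc M) (applyUpTo-interval suc 1 M λ _ → refl)
  where
  applyUpTo-interval : ∀ f a n → (∀ k → f k ≡ a + k) → applyUpTo f n ≡ interval a n
  applyUpTo-interval f a zero    f≗a+ = refl
  applyUpTo-interval f a (suc n) f≗a+ = cong₂ _∷_ (trans (f≗a+ 0) (+-identityʳ a))
    (applyUpTo-interval (f ∘ suc) (suc a) n λ k → trans (f≗a+ (suc k)) (+-suc a k))

findCol-nothing : ∀ C r α a n → findCol C r α (interval a n) ≡ nothing →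
                  ∀ j → a ≤ j → j < a + n → ¬ T (topAtLeast C r α j)
findCol-nothing C r α a zero    _  j a≤j j<a+0 =
  ⊥-elim (<⇒≱ j<a+0 (≤-trans (≤-reflexive (+-identityʳ a)) a≤j))
findCol-nothing C r α a (suc n) none j a≤j j<a+n with topAtLeast C r α a in fits-a
... | false with j ≟ a
...   | yes refl = λ fits → subst T fits-a fits
...   | no j≢a   = findCol-nothing C r α (suc a) n none j (≤∧≢⇒< a≤j (j≢a ∘ sym))
                     (≤-trans j<a+n (≤-reflexive (+-suc a n)))

record LeftmostFit (C : Filling) (r α a n i : ℕ) : Set where
  field
    lower    : a ≤ i
    upper    : i < a + n
    fits     : T (topAtLeast C r α i)
    leftmost : ∀ j → a ≤ j → j < i → ¬ T (topAtLeast C r α j)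

findCol-just : ∀ C r α a n {i} → findCol C r α (interval a n) ≡ just i → LeftmostFit C r α a n i
findCol-just C r α a (suc n) {i} found with topAtLeast C r α a in fits-a
findCol-just C r α a (suc n) refl | true = record
  { lower    = ≤-refl
  ; upper    = ≤-trans (s≤s (m≤m+n a n)) (≤-reflexive (sym (+-suc a n)))
  ; fits     = subst T (sym fits-a) _
  ; leftmost = λ j a≤j j<a → ⊥-elim (<⇒≱ j<a a≤j)
  }
... | false = record
  { lower    = <⇒≤ lower
  ; upper    = ≤-trans upper (≤-reflexive (sym (+-suc a n)))
  ; fits     = fits
  ; leftmost = leftmost′
  }
  where
  open LeftmostFit (findCol-just C r α (suc a) n found)
  leftmost′ : ∀ j → a ≤ j → j < i → ¬ T (topAtLeast C r α j)
  leftmost′ j a≤j j<i with j ≟ a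
  ... | yes refl = λ fits-j → subst T fits-a fits-j
  ... | no j≢a   = leftmost j (≤∧≢⇒< a≤j (j≢a ∘ sym)) j<i

module _ (C : Filling) (i α : ℕ) where

  addOnTop-≢ : ∀ {k} → k ≢ i → addOnTop C i α k ≡ C k
  addOnTop-≢ {k} k≢i with k ≡ᵇ i | ≡ᵇ⇒≡ k i
  ... | false | _   = refl
  ... | true  | k≡i = ⊥-elim (k≢i (k≡i _))

  addOnTop-≡ : addOnTop C i α i ≡ C i ++ α ∷ []
  addOnTop-≡ with i ≡ᵇ i | ≡⇒≡ᵇ i i refl
  ... | true | _ = refl

  ht-addOnTop-≡ : ht (addOnTop C i α) i ≡ suc (ht C i)
  ht-addOnTop-≡ = begin
    length (addOnTop C i α i)   ≡⟨ cong length addOnTop-≡ ⟩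
    length (C i ++ α ∷ [])      ≡⟨ length-++ (C i) ⟩
    length (C i) + 1            ≡⟨ +-comm (length (C i)) 1 ⟩
    suc (length (C i))          ∎
    where open ≡-Reasoning

  ht-addOnTop-≢ : ∀ {k} → k ≢ i → ht (addOnTop C i α) k ≡ ht C k
  ht-addOnTop-≢ k≢i = cong length (addOnTop-≢ k≢i)

  val-addOnTop-old : ∀ {k j} → j ≤ ht C k → val (addOnTop C i α) k j ≡ val C k j
  val-addOnTop-old {k} {zero}  _  = refl
  val-addOnTop-old {k} {suc j} j< with k ≟ i
  ... | yes refl = trans (cong (λ xs → at xs j) addOnTop-≡) (at-++ˡ (C i) (α ∷ []) j<)
  ... | no k≢i   = cong (λ xs → at xs j) (addOnTop-≢ k≢i)

  val-addOnTop-≢ : ∀ {k j} → k ≢ i → val (addOnTop C i α) k j ≡ val C k j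
  val-addOnTop-≢ {k} {zero}  _   = refl
  val-addOnTop-≢ {k} {suc j} k≢i = cong (λ xs → at xs j) (addOnTop-≢ k≢i)

  val-addOnTop-new : val (addOnTop C i α) i (suc (ht C i)) ≡ α
  val-addOnTop-new = trans (cong (λ xs → at xs (ht C i)) addOnTop-≡) (at-++-length (C i) [])

  ht-addOnTop-≥ : ∀ k → ht C k ≤ ht (addOnTop C i α) k
  ht-addOnTop-≥ k with k ≟ i
  ... | yes refl = ≤-trans (n≤1+n _) (≤-reflexive (sym ht-addOnTop-≡))
  ... | no k≢i   = ≤-reflexive (sym (ht-addOnTop-≢ k≢i))

  cell-addOnTop : ∀ {k j} → j ≤ ht (addOnTop C i α) k → j ≤ ht C k ⊎ (k ≡ i × j ≡ suc (ht C i))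
  cell-addOnTop {k} {j} j≤ with k ≟ i
  ... | no k≢i   = inj₁ (≤-trans j≤ (≤-reflexive (ht-addOnTop-≢ k≢i)))
  ... | yes refl with m≤n⇒m<n∨m≡n (≤-trans j≤ (≤-reflexive ht-addOnTop-≡))
  ...   | inj₁ j<  = inj₁ (≤-pred j<)
  ...   | inj₂ j≡ = inj₂ (refl , j≡)

NoDescent : Filling → Set
NoDescent C = ∀ i j → 1 ≤ i → suc j ≤ ht C i → val C i (suc j) ≤ val C i j

Positive : Filling → Set
Positive C = ∀ i j → 1 ≤ i → 1 ≤ j → j ≤ ht C i → 0 < val C i j

-- (i₂,k+1) was not put on (i₁,k) because a larger entry already occupied (i₁,k+1).
LeftCovered : Filling → Set
LeftCovered C = ∀ i₁ i₂ k → 1 ≤ i₁ → i₁ < i₂ → k ≤ ht C i₁ → suc k ≤ ht C i₂ →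
                val C i₂ (suc k) ≤ val C i₁ k →
                suc k ≤ ht C i₁ × val C i₂ (suc k) < val C i₁ (suc k)

record Valid (M : ℕ) (C : Filling) : Set where
  field
    bounded     : ∀ i → M < i → C i ≡ []
    noDescent   : NoDescent C
    positive    : Positive C
    leftCovered : LeftCovered C

valid-basement : ∀ M → Valid M (λ _ → [])
valid-basement M = record
  { bounded     = λ _ _ → refl
  ; noDescent   = λ _ _ _ ()
  ; positive    = λ { _ zero _ () _ ; _ (suc _) _ _ () }
  ; leftCovered = λ _ _ _ _ _ _ ()
  }

module _ {C : Filling} {i α : ℕ} where

  private
    C′ : Filling
    C′ = addOnTop C i α

  addOnTop-noDescent : NoDescent C → α ≤ val C i (ht C i) → NoDescent C′
  addOnTop-noDescent noDescent α≤top k j 1≤k j<ht′ with cell-addOnTop C i α j<ht′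
  ... | inj₁ j<ht = subst₂ _≤_ (sym (val-addOnTop-old C i α j<ht))
                      (sym (val-addOnTop-old C i α (<⇒≤ j<ht))) (noDescent k j 1≤k j<ht)
  ... | inj₂ (refl , refl) = subst₂ _≤_ (sym (val-addOnTop-new C i α))
                               (sym (val-addOnTop-old C i α ≤-refl)) α≤top

  addOnTop-positive : Positive C → 0 < α → Positive C′
  addOnTop-positive positive 0<α k j 1≤k 1≤j j≤ht′ with cell-addOnTop C i α j≤ht′
  ... | inj₁ j≤ht = subst (0 <_) (sym (val-addOnTop-old C i α j≤ht)) (positive k j 1≤k 1≤j j≤ht)
  ... | inj₂ (refl , refl) = subst (0 <_) (sym (val-addOnTop-new C i α)) 0<α

  skipped-column : ∀ {r j} → (∀ k → ht C k ≤ suc r) → (∀ k → ht C k ≡ suc r → α < val C k (suc r)) →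
                   (∀ j → 1 ≤ j → j < i → ¬ T (topAtLeast C r α j)) →
                   1 ≤ j → j < i → r ≤ ht C j → α ≤ val C j r → ht C j ≡ suc r × α < val C j (suc r)
  skipped-column {r} {j} heights above leftmost 1≤j j<i r≤ht α≤ with m≤n⇒m<n∨m≡n r≤ht
  ... | inj₁ r<ht = ht≡ , above j ht≡
    where
    ht≡ : ht C j ≡ suc r
    ht≡ = ≤-antisym (heights j) r<ht
  ... | inj₂ r≡ht = ⊥-elim (leftmost j 1≤j j<i (topAtLeast-T (sym r≡ht) α≤))

  addOnTop-leftCovered : ∀ {r} → LeftCovered C → ht C i ≡ r → (∀ k → ht C k ≤ suc r) →
                         (∀ k → ht C k ≡ suc r → α < val C k (suc r)) →
                         (∀ j → 1 ≤ j → j < i → ¬ T (topAtLeast C r α j)) → LeftCovered C′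
  addOnTop-leftCovered covered refl heights above leftmost i₁ i₂ k 1≤i₁ i₁<i₂ k≤ht′₁ k<ht′₂ fits′
    with cell-addOnTop C i α k<ht′₂
  ... | inj₁ k<ht₂ =
    ≤-trans k<ht₁ (ht-addOnTop-≥ C i α i₁) ,
    subst₂ _<_ (sym (val-addOnTop-old C i α k<ht₂)) (sym (val-addOnTop-old C i α k<ht₁)) lt
    where
    k≤ht₁ : k ≤ ht C i₁
    k≤ht₁ with cell-addOnTop C i α k≤ht′₁
    ... | inj₁ k≤ht₁      = k≤ht₁
    ... | inj₂ (_ , refl) = ⊥-elim (<-irrefl refl (≤-trans k<ht₂ (heights i₂)))
    fits : val C i₂ (suc k) ≤ val C i₁ k
    fits = subst₂ _≤_ (val-addOnTop-old C i α k<ht₂) (val-addOnTop-old C i α k≤ht₁) fits′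
    k<ht₁ : suc k ≤ ht C i₁
    k<ht₁ = proj₁ (covered i₁ i₂ k 1≤i₁ i₁<i₂ k≤ht₁ k<ht₂ fits)
    lt : val C i₂ (suc k) < val C i₁ (suc k)
    lt = proj₂ (covered i₁ i₂ k 1≤i₁ i₁<i₂ k≤ht₁ k<ht₂ fits)
  ... | inj₂ (refl , refl) =
    ≤-trans (≤-reflexive (sym ht₁≡)) (ht-addOnTop-≥ C i α i₁) ,
    subst₂ _<_ (sym (val-addOnTop-new C i α)) (sym (val-addOnTop-old C i α (≤-reflexive (sym ht₁≡)))) α<
    where
    r≤ht₁ : ht C i ≤ ht C i₁
    r≤ht₁ = ≤-trans k≤ht′₁ (≤-reflexive (ht-addOnTop-≢ C i α (<⇒≢ i₁<i₂)))
    α≤ : α ≤ val C i₁ (ht C i)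
    α≤ = subst₂ _≤_ (val-addOnTop-new C i α) (val-addOnTop-old C i α r≤ht₁) fits′
    ht₁≡ : ht C i₁ ≡ suc (ht C i)
    ht₁≡ = proj₁ (skipped-column heights above leftmost 1≤i₁ i₁<i₂ r≤ht₁ α≤)
    α< : α < val C i₁ (suc (ht C i))
    α< = proj₂ (skipped-column heights above leftmost 1≤i₁ i₁<i₂ r≤ht₁ α≤)

  topAtLeast-addOnTop : ∀ s v → AgreeOff (topAtLeast C s v) (topAtLeast C′ s v) i
  topAtLeast-addOnTop s v j j≢i =
    cong₂ (λ h x → (h ≡ᵇ s) ∧ (v ≤ᵇ x)) (sym (ht-addOnTop-≢ C i α j≢i))
      (sym (val-addOnTop-≢ C i α {j} {s} j≢i))

  tops-addOnTop-≤-suc : ∀ r v M → tops C r v M ≤ suc (tops C′ r v M)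
  tops-addOnTop-≤-suc r v =
    countTo-≤-suc-update (topAtLeast C r v) (topAtLeast C′ r v) i (topAtLeast-addOnTop r v)

  column-not-top-of-next-row : ∀ v → ¬ T (topAtLeast C (suc (ht C i)) v i)
  column-not-top-of-next-row v top = 1+n≢n (sym (proj₁ (T-topAtLeast {C} {suc (ht C i)} {v} {i} top)))

  tops-addOnTop-mono : ∀ {r} → ht C i ≡ r → ∀ v M → tops C (suc r) v M ≤ tops C′ (suc r) v M
  tops-addOnTop-mono refl v = countTo-≤-update (topAtLeast C _ v) (topAtLeast C′ _ v) i
    (topAtLeast-addOnTop _ v) (column-not-top-of-next-row v)

  tops-addOnTop-grows : ∀ {r} → ht C i ≡ r → ∀ v M → v ≤ α → 1 ≤ i → i ≤ M →
                        tops C (suc r) v M < tops C′ (suc r) v M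
  tops-addOnTop-grows refl v M v≤α =
    countTo-<-update (topAtLeast C _ v) (topAtLeast C′ _ v) i (topAtLeast-addOnTop _ v)
      (column-not-top-of-next-row v)
      (topAtLeast-T {C′} {suc (ht C i)} {v} {i} (ht-addOnTop-≡ C i α)
        (subst (v ≤_) (sym (val-addOnTop-new C i α)) v≤α))
      M

record RowChain (rows : List (List ℕ)) : Set where
  field
    decreasing : ∀ h → AllPairs _>_ (rowAt rows h)
    positive   : ∀ h → All (0 <_) (rowAt rows h)
    dominated  : ∀ h v → countGE v (rowAt rows (suc h)) ≤ countGE v (rowAt rows h)

RowChain-tail : ∀ {row rows} → RowChain (row ∷ rows) → RowChain rows
RowChain-tail chain = record
  { decreasing = decreasing ∘ suc
  ; positive   = positive ∘ suc
  ; dominated  = dominated ∘ suc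
  }
  where open RowChain chain

module Placement (M : ℕ) where

  -- R, a row of P, is being placed on the columns ending in row r; L is what remains of R.
  record RowInProgress (r : ℕ) (R : List ℕ) (C : Filling) (L : List ℕ) : Set where
    field
      valid      : Valid M C
      heights    : ∀ k → ht C k ≤ suc r
      above      : ∀ k → ht C k ≡ suc r → All (_< val C k (suc r)) L
      decreasing : AllPairs _>_ L
      positive   : All (0 <_) L
      supply     : ∀ v → countGE v L ≤ tops C r v M
      progress   : ∀ v → countGE v R ≤ tops C (suc r) v M + countGE v L

  record RowDone (r : ℕ) (R : List ℕ) (C : Filling) : Set where
    field
      valid     : Valid M C
      heights   : ∀ k → ht C k ≤ suc r
      dominates : ∀ v → countGE v R ≤ tops C (suc r) v M

  module _ {r : ℕ} {R : List ℕ} {C : Filling} {α : ℕ} {as : List ℕ}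
           (st : RowInProgress r R C (α ∷ as)) where

    open RowInProgress st

    no-room : findCol C r α (interval 1 M) ≡ nothing → ⊥
    no-room none = n≮0 (begin
      suc (countGE α as)  ≡⟨ countGE-accept as ≤-refl ⟨
      countGE α (α ∷ as)  ≤⟨ supply α ⟩
      tops C r α M        ≡⟨ countTo-none (topAtLeast C r α) M
                               (λ j 1≤j j≤M → findCol-nothing C r α 1 M none j 1≤j (s≤s j≤M)) ⟩
      0                   ∎)
      where open ≤-Reasoning

    module _ {i : ℕ} (fit : LeftmostFit C r α 1 M i) where

      open LeftmostFit fit

      private
        C′ : Filling
        C′ = addOnTop C i α
        i≤M : i ≤ M
        i≤M = ≤-pred upper
        ht≡r : ht C i ≡ r
        ht≡r = proj₁ (T-topAtLeast {C} {r} {α} {i} fits)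
        α≤ : α ≤ val C i r
        α≤ = proj₂ (T-topAtLeast {C} {r} {α} {i} fits)
        as<α : All (_< α) as
        as<α with xs<x ∷ _ ← decreasing = xs<x

      supply-after : ∀ v → countGE v as ≤ tops C′ r v M
      supply-after v with v ≤? α
      ... | yes v≤α = ≤-pred (begin
        suc (countGE v as)  ≡⟨ countGE-accept as v≤α ⟨
        countGE v (α ∷ as)  ≤⟨ supply v ⟩
        tops C r v M        ≤⟨ tops-addOnTop-≤-suc r v M ⟩
        suc (tops C′ r v M) ∎)
        where open ≤-Reasoning
      ... | no v≰α = ≤-trans (≤-reflexive (countGE-below as<v)) z≤n
        where
        as<v : All (_< v) as
        as<v = All.map (λ y<α → <-trans y<α (≰⇒> v≰α)) as<α

      progress-after : ∀ v → countGE v R ≤ tops C′ (suc r) v M + countGE v as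
      progress-after v with v ≤? α
      ... | yes v≤α = begin
        countGE v R                              ≤⟨ progress v ⟩
        tops C (suc r) v M + countGE v (α ∷ as)  ≡⟨ cong (tops C (suc r) v M +_) (countGE-accept as v≤α) ⟩
        tops C (suc r) v M + suc (countGE v as)  ≡⟨ +-suc _ _ ⟩
        suc (tops C (suc r) v M) + countGE v as  ≤⟨ +-monoˡ-≤ _ (tops-addOnTop-grows ht≡r v M v≤α lower i≤M) ⟩
        tops C′ (suc r) v M + countGE v as       ∎
        where open ≤-Reasoning
      ... | no v≰α = begin
        countGE v R                              ≤⟨ progress v ⟩
        tops C (suc r) v M + countGE v (α ∷ as)  ≡⟨ cong (tops C (suc r) v M +_) (countGE-reject as v≰α) ⟩
        tops C (suc r) v M + countGE v as        ≤⟨ +-monoˡ-≤ _ (tops-addOnTop-mono ht≡r v M) ⟩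
        tops C′ (suc r) v M + countGE v as       ∎
        where open ≤-Reasoning

      heights-after : ∀ k → ht C′ k ≤ suc r
      heights-after k with cell-addOnTop C i α (≤-refl {ht C′ k})
      ... | inj₁ ht′≤ht      = ≤-trans ht′≤ht (heights k)
      ... | inj₂ (refl , ht′≡) = ≤-reflexive (trans ht′≡ (cong suc ht≡r))

      above-after : ∀ k → ht C′ k ≡ suc r → All (_< val C′ k (suc r)) as
      above-after k ht′≡ with cell-addOnTop C i α (≤-reflexive (sym ht′≡))
      ... | inj₁ r<ht = subst (λ t → All (_< t) as) (sym (val-addOnTop-old C i α r<ht))
                          (All.tail (above k (≤-antisym (heights k) r<ht)))
      ... | inj₂ (refl , r≡) = subst (λ t → All (_< t) as)
                                 (sym (trans (cong (val C′ i) r≡) (val-addOnTop-new C i α))) as<α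

      valid-after : Valid M C′
      valid-after = record
        { bounded     = λ k M<k → trans (addOnTop-≢ C i α (λ { refl → <⇒≱ M<k i≤M })) (bounded k M<k)
        ; noDescent   = addOnTop-noDescent noDescent (subst (λ h → α ≤ val C i h) (sym ht≡r) α≤)
        ; positive    = addOnTop-positive positive′ 0<α
        ; leftCovered = addOnTop-leftCovered leftCovered ht≡r heights (λ k → All.head ∘ above k) leftmost
        }
        where
        open Valid valid renaming (positive to positive′)
        0<α : 0 < α
        0<α = All.head positive

      place : RowInProgress r R C′ as
      place = record
        { valid      = valid-after
        ; heights    = heights-after
        ; above      = above-after
        ; decreasing = AllPairs.tail decreasing
        ; positive   = All.tail positive
        ; supply     = supply-after
        ; progress   = progress-after
        }

  findCol-columns : ∀ {C r α} → findCol C r α (map suc (upTo M)) ≡ findCol C r α (interval 1 M)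
  findCol-columns {C} {r} {α} = cong (findCol C r α) (columns≡interval M)

  placeRow-succeeds : ∀ {r R} L C → RowInProgress r R C L →
                      Σ Filling λ C′ → placeRow M r L C ≡ just C′ × RowDone r R C′
  placeRow-succeeds [] C st = C , refl , record
    { valid     = valid
    ; heights   = heights
    ; dominates = λ v → ≤-trans (progress v) (≤-reflexive (+-identityʳ _))
    }
    where open RowInProgress st
  placeRow-succeeds {r} (α ∷ as) C st with findCol C r α (map suc (upTo M)) in found
  ... | nothing = ⊥-elim (no-room st (trans (sym findCol-columns) found))
  ... | just i  = placeRow-succeeds as (addOnTop C i α)
                    (place st (findCol-just C r α 1 M (trans (sym findCol-columns) found)))

  startRow : ∀ {r row rows C} → Valid M C → (∀ k → ht C k ≤ r) → RowChain (row ∷ rows) →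
             (∀ v → countGE v row ≤ tops C r v M) → RowInProgress r row C row
  startRow valid heights chain supply = record
    { valid      = valid
    ; heights    = λ k → m≤n⇒m≤1+n (heights k)
    ; above      = λ k ht≡ → ⊥-elim (1+n≰n (≤-trans (≤-reflexive (sym ht≡)) (heights k)))
    ; decreasing = RowChain.decreasing chain 0
    ; positive   = RowChain.positive chain 0
    ; supply     = supply
    ; progress   = λ v → m≤n+m _ _
    }

  build-succeeds : ∀ rows r C → Valid M C → (∀ k → ht C k ≤ r) → RowChain rows →
                   (∀ v → countGE v (rowAt rows 0) ≤ tops C r v M) →
                   Σ Filling λ C′ → build M r rows C ≡ just C′ × Valid M C′
  build-succeeds []           r C valid heights chain supply = C , refl , valid
  build-succeeds (row ∷ rows) r C valid heights chain supply
    with placeRow-succeeds row C (startRow valid heights chain supply)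
  ... | C′ , placed , done rewrite placed =
    build-succeeds rows (suc r) C′ (RowDone.valid done) (RowDone.heights done)
      (RowChain-tail chain) (λ v → ≤-trans (RowChain.dominated chain 0 v) (RowDone.dominates done v))

module _ {M : ℕ} {C : Filling} (valid : Valid M C) where

  open Valid valid

  fits-left⇒not-taller : ∀ {i₁ i₂ k} → 1 ≤ i₁ → i₁ < i₂ → k ≤ ht C i₁ → suc k ≤ ht C i₂ →
                         val C i₂ (suc k) ≤ val C i₁ k → ht C i₂ ≤ ht C i₁
  fits-left⇒not-taller {i₁} {i₂} {k} 1≤i₁ i₁<i₂ k≤ht₁ k<ht₂ fits =
    climb k (proj₁ (m≤n⇒∃[o]m+o≡n k<ht₂)) (proj₂ (m≤n⇒∃[o]m+o≡n k<ht₂)) k≤ht₁ fits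
    where
    climb : ∀ k d → suc k + d ≡ ht C i₂ → k ≤ ht C i₁ → val C i₂ (suc k) ≤ val C i₁ k →
            ht C i₂ ≤ ht C i₁
    climb k d ht₂≡ k≤ht₁ fits with leftCovered i₁ i₂ k 1≤i₁ i₁<i₂ k≤ht₁
                                     (≤-trans (m≤m+n (suc k) d) (≤-reflexive ht₂≡)) fits
    climb k zero    ht₂≡ _ _ | k<ht₁ , _  = ≤-trans (≤-reflexive (trans (sym ht₂≡) (+-identityʳ _))) k<ht₁
    climb k (suc d) ht₂≡ _ _ | k<ht₁ , lt = climb (suc k) d ht₂≡′ k<ht₁ (≤-trans descent (<⇒≤ lt))
      where
      ht₂≡′ : suc (suc k) + d ≡ ht C i₂
      ht₂≡′ = trans (sym (+-suc (suc k) d)) ht₂≡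
      descent : val C i₂ (suc (suc k)) ≤ val C i₂ (suc k)
      descent = noDescent i₂ (suc k) (≤-trans 1≤i₁ (<⇒≤ i₁<i₂)) (≤-trans (m≤m+n _ d) (≤-reflexive ht₂≡′))

  Valid⇒IsSSAF : IsSSAF C
  Valid⇒IsSSAF = record
    { augmented = record { finite = M , bounded ; positive = positive }
    ; noDescent = noDescent
    ; typeA     = typeA
    ; typeB     = typeB
    }
    where
    typeA : ∀ i₁ i₂ j → 1 ≤ i₁ → i₁ < i₂ → ht C i₂ ≤ ht C i₁ → 1 ≤ j → j ≤ ht C i₂ →
            Iℤ (val C i₁ j) (val C i₂ j) ℤ.+ Iℤ (val C i₂ j) (val C i₁ (j ∸ 1))
              ℤ.- Iℤ (val C i₁ j) (val C i₁ (j ∸ 1)) ≡ ℤ.+ 1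
    typeA i₁ i₂ (suc k) 1≤i₁ i₁<i₂ ht₂≤ht₁ _ k<ht₂ =
      inversionTriple (noDescent i₁ k 1≤i₁ k<ht₁)
        (proj₂ ∘ leftCovered i₁ i₂ k 1≤i₁ i₁<i₂ (<⇒≤ k<ht₁) k<ht₂)
      where
      k<ht₁ : suc k ≤ ht C i₁
      k<ht₁ = ≤-trans k<ht₂ ht₂≤ht₁
    typeB : ∀ i₁ i₂ j → 1 ≤ i₁ → i₁ < i₂ → ht C i₁ < ht C i₂ → j ≤ ht C i₁ →
            Iℤ (val C i₂ (suc j)) (val C i₁ j) ℤ.+ Iℤ (val C i₁ j) (val C i₂ j)
              ℤ.- Iℤ (val C i₂ (suc j)) (val C i₂ j) ≡ ℤ.+ 1
    typeB i₁ i₂ j 1≤i₁ i₁<i₂ ht₁<ht₂ j≤ht₁ =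
      inversionTriple (noDescent i₂ j (≤-trans 1≤i₁ (<⇒≤ i₁<i₂)) j<ht₂)
        (λ _ → ≰⇒> λ fits → <⇒≱ ht₁<ht₂ (fits-left⇒not-taller 1≤i₁ i₁<i₂ j≤ht₁ j<ht₂ fits))
      where
      j<ht₂ : suc j ≤ ht C i₂
      j<ht₂ = ≤-trans (s≤s j≤ht₁) ht₁<ht₂

rowChain : ∀ {P} → IsReverseSSYT P → RowChain P
rowChain {P} ssyt = record
  { decreasing = λ h → Linked⇒AllPairs (λ y<x z<y → <-trans z<y y<x)
                                        (linked-at (rowAt P h) (rowStrict h))
  ; positive   = λ h → all-at (rowAt P h) (positive h)
  ; dominated  = λ h → countGE-mono-at (rowAt P (suc h)) (rowAt P h) (shape h) (colWeak h)
  }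
  where open IsReverseSSYT ssyt

-- The basement entry of column j is j, so tops (λ _ → []) 0 v n reduces to countTo (v ≤ᵇ_) n.
basement-supply : ∀ P → IsReverseSSYT P → ∀ v →
                  countGE v (rowAt P 0) ≤ tops (λ _ → []) 0 v (maxEntry P)
basement-supply []       _    v = z≤n
basement-supply (q ∷ qs) ssyt v =
  countGE-≤-countTo v (maxEntry (q ∷ qs)) q (decreasing 0) (positive 0)
    (++⁻ˡ q (≤-foldr-⊔ (q ++ concat qs)))
  where open RowChain (rowChain ssyt)

lemma3p1 : (P : List (List ℕ)) → IsReverseSSYT P →
           Σ Filling (λ F → (ρinv P ≡ just F) × IsSSAF F)
lemma3p1 P ssyt with Placement.build-succeeds (maxEntry P) P 0 (λ _ → []) (valid-basement (maxEntry P))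
                    (λ _ → z≤n) (rowChain ssyt) (basement-supply P ssyt)
... | F , built , valid = F , built , Valid⇒IsSSAF valid
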